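{- Let $\mathcal{F}$ be a family and $X$ a set such that $\mathcal{F}(X) \neq \emptyset$. Then \[\mu(\{F \setminus X \colon F \in \mathcal{F}(X)\}) \geq \mu(\mathcal{F}) - |X|.\]
   Context: All sets and families (sets of sets) are finite. For a family $\mathcal{F}$ and a set $X$, $\mathcal{F}(X) = \{A \in \mathcal{F} \colon X \subseteq A\}$. A set $B \in \mathcal{F}$ is a base of $\mathcal{F}$ if $B$ is not a proper subset of any $A \in \mathcal{F}$; $\mu(\mathcal{F})$ is the size of a smallest base of $\mathcal{F}$. -}

module Defs where

open import Level using (0ℓ)
open import Data.Nat using (ℕ; _≤_)
open import Data.Product using (_×_; ∃; ∃-syntax)
open import Data.Fin.Subset using (Subset; _⊆_; _⊂_; _─_; ∣_∣)
open import Relation.Nullary using (¬_)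
open import Relation.Unary using (Pred)
open import Relation.Binary.PropositionalEquality using (_≡_)

-- Sets are subsets of the finite ground set Fin n; a family is a
-- predicate on Subset n (automatically finite).
Family : ℕ → Set₁
Family n = Pred (Subset n) 0ℓ

_⟨_⟩ : ∀ {n} → Family n → Subset n → Family n
(𝓕 ⟨ X ⟩) A = 𝓕 A × (X ⊆ A)

removeFrom : ∀ {n} → Family n → Subset n → Family n
removeFrom 𝓕 X A = ∃[ F ] ((𝓕 ⟨ X ⟩) F × (A ≡ F ─ X))

IsBase : ∀ {n} → Family n → Subset n → Set
IsBase 𝓕 B = 𝓕 B × (¬ (∃[ A ] (𝓕 A × (B ⊂ A))))

IsMu : ∀ {n} → Family n → ℕ → Set
IsMu 𝓕 k = (∃[ B ] (IsBase 𝓕 B × ∣ B ∣ ≡ k)) × (∀ B → IsBase 𝓕 B → k ≤ ∣ B ∣)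

-- If F ∖ X is a smallest base of { F ∖ X : F ∈ 𝓕(X) }, then F itself is a
-- base of 𝓕: a proper superset A ∈ 𝓕 of F also contains X, and removing X
-- keeps A ∖ X a proper superset of F ∖ X, because the element of A outside F
-- is not in X ⊆ F. Hence μ(𝓕) ≤ |F| ≤ |F ∖ X| + |X|.
module Submission where

open import Defs
open import Data.Nat using (ℕ; _≤_; _∸_; _+_; suc; s≤s; z≤n)
open import Data.Nat.Properties using (≤-trans; m≤n+o⇒m∸n≤o; +-suc; m≤n⇒m≤1+n)
open import Data.Product using (∃-syntax; _,_)
open import Data.Vec using (_∷_; []; here; there)
open import Data.Fin.Subset using (Subset; _⊆_; _⊂_; ∣_∣; _─_; _∈_; _∉_; outside; inside)
open import Data.Fin.Subset.Properties using (p─q⊆p; x∈p∧x∉q⇒x∈p─q; ⊆-trans)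
open import Relation.Binary.PropositionalEquality using (refl; sym; subst)

private
  variable
    n : ℕ

x∈p─q⇒x∉q : ∀ {x} (p q : Subset n) → x ∈ p ─ q → x ∉ q
x∈p─q⇒x∉q (_ ∷ p) (inside  ∷ q) ()          here
x∈p─q⇒x∉q (_ ∷ p) (outside ∷ q) here        ()
x∈p─q⇒x∉q (_ ∷ p) (_       ∷ q) (there x∈) (there x∈q) = x∈p─q⇒x∉q p q x∈ x∈q

∣p∣≤∣q∣+∣p─q∣ : ∀ (p q : Subset n) → ∣ p ∣ ≤ ∣ q ∣ + ∣ p ─ q ∣
∣p∣≤∣q∣+∣p─q∣ []            []            = z≤n
∣p∣≤∣q∣+∣p─q∣ (outside ∷ p) (outside ∷ q) = ∣p∣≤∣q∣+∣p─q∣ p q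
∣p∣≤∣q∣+∣p─q∣ (outside ∷ p) (inside  ∷ q) = m≤n⇒m≤1+n (∣p∣≤∣q∣+∣p─q∣ p q)
∣p∣≤∣q∣+∣p─q∣ (inside  ∷ p) (inside  ∷ q) = s≤s (∣p∣≤∣q∣+∣p─q∣ p q)
∣p∣≤∣q∣+∣p─q∣ (inside  ∷ p) (outside ∷ q) =
  subst (suc ∣ p ∣ ≤_) (sym (+-suc ∣ q ∣ ∣ p ─ q ∣)) (s≤s (∣p∣≤∣q∣+∣p─q∣ p q))

p⊆q⇒p─r⊆q─r : ∀ {p q : Subset n} (r : Subset n) → p ⊆ q → p ─ r ⊆ q ─ r
p⊆q⇒p─r⊆q─r {p = p} r p⊆q x∈p─r =
  x∈p∧x∉q⇒x∈p─q (p⊆q (p─q⊆p p r x∈p─r)) (x∈p─q⇒x∉q p r x∈p─r)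

r⊆p∧p⊂q⇒p─r⊂q─r : ∀ {p q r : Subset n} → r ⊆ p → p ⊂ q → p ─ r ⊂ q ─ r
r⊆p∧p⊂q⇒p─r⊂q─r {p = p} {r = r} r⊆p (p⊆q , x , x∈q , x∉p) =
  p⊆q⇒p─r⊆q─r r p⊆q ,
  x , x∈p∧x∉q⇒x∈p─q x∈q (λ x∈r → x∉p (r⊆p x∈r)) , λ x∈p─r → x∉p (p─q⊆p p r x∈p─r)

base-of-removeFrom⇒base : ∀ (𝓕 : Family n) (X : Subset n) {F : Subset n} →
                          (𝓕 ⟨ X ⟩) F → IsBase (removeFrom 𝓕 X) (F ─ X) → IsBase 𝓕 F
base-of-removeFrom⇒base 𝓕 X (𝓕F , X⊆F) (_ , F─X-maximal) =
  𝓕F , λ { (A , 𝓕A , F⊂A@(F⊆A , _)) →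
    F─X-maximal (A ─ X , (A , (𝓕A , ⊆-trans X⊆F F⊆A) , refl) , r⊆p∧p⊂q⇒p─r⊂q─r X⊆F F⊂A) }

-- The nonemptiness of 𝓕(X) is implied by the existence of a base of
-- removeFrom 𝓕 X, which IsMu provides.
lemma2p3 : ∀ {n} (𝓕 : Family n) (X : Subset n) → (∃[ A ] ((𝓕 ⟨ X ⟩) A)) →
             ∀ (k m : ℕ) → IsMu 𝓕 k → IsMu (removeFrom 𝓕 X) m → k ∸ ∣ X ∣ ≤ m
lemma2p3 𝓕 X _ k m (_ , k-minimal) ((_ , F─X-base@((F , 𝓕⟨X⟩F , refl) , _) , refl) , _) =
  m≤n+o⇒m∸n≤o k ∣ X ∣ (≤-trans k≤∣F∣ (∣p∣≤∣q∣+∣p─q∣ F X))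
  where
  k≤∣F∣ : k ≤ ∣ F ∣
  k≤∣F∣ = k-minimal F (base-of-removeFrom⇒base 𝓕 X 𝓕⟨X⟩F F─X-base)
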